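{- Let $\alpha\in\mathrm{Comp}(n,s)$ with $\alpha_i\ge\lambda_i$ for all $i$, and let $(i_1,j_1),\dots,(i_\ell,j_\ell)$ be the free pairs for $\alpha$, listed so that $i_1\ge i_2\ge\cdots\ge i_\ell$. Then for all $p\le\ell$ and all $t_1,\dots,t_p\in\mathbb{F}$, \[ U_{i_p,j_p}(t_p)U_{i_{p-1},j_{p-1}}(t_{p-1})\cdots U_{i_1,j_1}(t_1)\,\mathbb{F}^\alpha=\widehat U_{i_p,j_p}(t_p)\widehat U_{i_{p-1},j_{p-1}}(t_{p-1})\cdots\widehat U_{i_1,j_1}(t_1)\,\mathbb{F}^\alpha. \]
   Context: Setup: $\mathbb{F}$ a field, $n\ge0$, $\lambda$ a partition of $k\le n$, $s\ge\ell(\lambda)$, $\lambda_i=0$ for $i>\ell(\lambda)$, $\Lambda=(\lambda_1+n-k,\dots,\lambda_s+n-k)$, $K=k+(n-k)s$. $[\Lambda]=\{(i,j):1\le i\le s,1\le j\le\Lambda_i\}$ (row $i$ from the top, column $j$ from the left), $[\lambda]=\{(i,j):1\le j\le\lambda_i\}$. $T:[\Lambda]\to\{1,\dots,K\}$ is the reverse reading order filling: $T(i,j)=\ell$ iff $(i,j)$ is the $\ell$th cell when reading down each column (top to bottom), columns taken from left to right; $T(c)$ is the label of $c$. With $f_1,\dots,f_K$ the standard basis of $\mathbb{F}^K$: $Nf_{T(i,j)}=f_{T(i,j+1)}$ if $j<\Lambda_i$, $Nf_{T(i,\Lambda_i)}=0$; $N^tf_{T(i,j)}=f_{T(i,j-1)}$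 if $j>1$, $N^tf_{T(i,1)}=0$. $\mathrm{Comp}(n,s)$ is the set of $s$-tuples of nonnegative integers summing to $n$; $[\alpha]=\{(i,j):1\le j\le\alpha_i\}$; $\mathbb{F}^\alpha=\mathrm{span}\{f_{T(c)}:c\in[\alpha]\}$. A free pair for $\alpha$ is a pair of labels $(i,j)$ with $i>j$ such that the cell labeled $i$ lies in $[\alpha]\setminus[\lambda]$ and the cell labeled $j$ is the leftmost cell of $[\Lambda]\setminus[\alpha]$ in its row. For a free pair $(i,j)$ and $t\in\mathbb{F}$, $U_{i,j}(t)$ is the linear map with $U_{i,j}(t)(N^mf_i)=N^m(f_i+tf_j)$ and $U_{i,j}(t)((N^t)^mf_i)=(N^t)^m(f_i+tf_j)$ for all $m\ge0$, and $U_{i,j}(t)f_\ell=f_\ell$ for every label $\ell$ not in the row of $i$. $\widehat U_{i,j}(t)$ is the linear map with $\widehat U_{i,j}(t)(N^mf_i)=N^m(f_i+tf_j)$ for all $m\ge0$ and $\widehat U_{i,j}(t)f_\ell=f_\ell$ for every label $\ell$ that is either not in the row of $i$ or not weakly to the right of the cell of $i$. -}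

module Defs where

open import Level using (Level; _⊔_) renaming (suc to lsuc)
open import Algebra.Bundles using (CommutativeRing)
open import Data.Nat using (ℕ; zero; suc; _+_; _*_; _∸_; _≤_; _<_; _≤?_; _<?_)
open import Data.Fin using (Fin; toℕ; fromℕ<)
import Data.Fin as Fin
open import Data.Fin.Properties using () renaming (_≟_ to _≟ᶠ_)
open import Data.Nat.Properties using () renaming (_≟_ to _≟ℕ_)
open import Data.Product using (Σ; ∃; _×_; _,_)
open import Data.List using (List; []; _∷_)
open import Relation.Nullary using (¬_; yes; no)
open import Relation.Binary.PropositionalEquality using (_≡_)

record Field (c ℓ : Level) : Set (lsuc (c ⊔ ℓ)) where
  field
    commutativeRing : CommutativeRing c ℓ
  open CommutativeRing commutativeRing public
  field
    1≉0     : ¬ (1# ≈ 0#)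
    inverse : ∀ x → ¬ (x ≈ 0#) → ∃ λ y → (CommutativeRing._*_ commutativeRing x y) ≈ 1#

sumℕ : ∀ s → (Fin s → ℕ) → ℕ
sumℕ zero    f = 0
sumℕ (suc s) f = f Fin.zero + sumℕ s (λ i → f (Fin.suc i))

-- Shapes.
-- A partition λ of k with at most s parts, padded with zeros
-- (λ_i = 0 for i > ℓ(λ)), is a weakly decreasing  λ : Fin s → ℕ
-- with  Σ λ_i = k.

IsPaddedPartition : (k s : ℕ) → (Fin s → ℕ) → Set
IsPaddedPartition k s lam =
  (∀ (i j : Fin s) → toℕ i ≤ toℕ j → lam j ≤ lam i) × (sumℕ s lam ≡ k)

IsComp : (n s : ℕ) → (Fin s → ℕ) → Set
IsComp n s α = sumℕ s α ≡ n

Λ : (n k s : ℕ) → (Fin s → ℕ) → Fin s → ℕ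
Λ n k s lam i = lam i + (n ∸ k)

-- Cells are pairs (row r, column c) with rows r : Fin s (row toℕ r + 1
-- in the paper) and columns c : ℕ 0-indexed (column c + 1 in the paper).
-- The cell (r , c) lies in [Λ] iff c < Λ r.

lt01 : ℕ → ℕ → ℕ
lt01 c m with c <? m
... | yes _ = 1
... | no  _ = 0

le01 : ∀ {s} → Fin s → Fin s → ℕ
le01 r' r with toℕ r' ≤? toℕ r
... | yes _ = 1
... | no  _ = 0

module Shape (s : ℕ) (Lam : Fin s → ℕ) where

  colCount : ℕ → ℕ
  colCount c = sumℕ s (λ r' → lt01 c (Lam r'))

  cellsBefore : ℕ → ℕ
  cellsBefore zero    = 0
  cellsBefore (suc c) = cellsBefore c + colCount c

  -- The reverse reading order filling T (labels 1..K): reading down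
  -- each column, columns from left to right.
  T : Fin s → ℕ → ℕ
  T r c = cellsBefore c + sumℕ s (λ r' → le01 r' r * lt01 c (Lam r'))

-- A (candidate) pair of labels (i , j), given through their cells:
-- the cell of label i is (r , a), the cell of label j is (r' , b)
-- (rows in Fin s, 0-indexed columns).  Since T is a bijection between
-- [Λ] and {1..K}, this is the same data as the pair of labels.
record CellPair (s : ℕ) : Set where
  constructor cp
  field
    r  : Fin s
    a  : ℕ
    r' : Fin s
    b  : ℕ

-- Vectors of F^K, indexed by the cells of [Λ] (equivalently by their
-- labels T(c), since T is a bijection [Λ] → {1..K}).

module LinAlg {c ℓ} (F : Field c ℓ) (s : ℕ) (Lam : Fin s → ℕ) where
  open Field F renaming (_+_ to _+F_; _*_ to _*F_)

  Vect : Set c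
  Vect = (r : Fin s) → Fin (Lam r) → Carrier

  _≈V_ : Vect → Vect → Set ℓ
  v ≈V w = ∀ r i → v r i ≈ w r i

  _+V_ : Vect → Vect → Vect
  (v +V w) r i = v r i +F w r i

  _•_ : Carrier → Vect → Vect
  (a • v) r i = a *F v r i

  0V : Vect
  0V _ _ = 0#

  -- entry of v at cell (r , m), with m : ℕ; 0 outside [Λ]
  get : Vect → Fin s → ℕ → Carrier
  get v r m with m <? Lam r
  ... | yes p = v r (fromℕ< p)
  ... | no  _ = 0#

  -- standard basis vector f_{T(r , m)}  (the zero vector if (r , m) ∉ [Λ])
  f : Fin s → ℕ → Vect
  f r m r' i with r ≟ᶠ r' | m ≟ℕ toℕ i
  ... | yes _ | yes _ = 1#
  ... | _     | _     = 0#

  -- N f_{T(i,j)} = f_{T(i,j+1)} (or 0 at the end of the row)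
  N : Vect → Vect
  N v r i with toℕ i
  ... | zero  = 0#
  ... | suc m = get v r m

  -- Nᵗ f_{T(i,j)} = f_{T(i,j-1)} (or 0 at the start of the row)
  Nᵗ : Vect → Vect
  Nᵗ v r i = get v r (suc (toℕ i))

  iter : ℕ → (Vect → Vect) → Vect → Vect
  iter zero    g v = v
  iter (suc m) g v = g (iter m g v)

  ΣV : ∀ n → (Fin n → Vect) → Vect
  ΣV zero    g = 0V
  ΣV (suc n) g = g Fin.zero +V ΣV n (λ i → g (Fin.suc i))

  ΣCells : ((r : Fin s) → Fin (Lam r) → Vect) → Vect
  ΣCells g = ΣV s (λ r → ΣV (Lam r) (λ i → g r i))

  linMap : ((r : Fin s) → Fin (Lam r) → Vect) → Vect → Vect
  linMap col v = ΣCells (λ r i → v r i • col r i)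

  -- F^α = span { f_{T(c)} : c ∈ [α] }  (finite linear combinations)
  InFα : (Fin s → ℕ) → Vect → Set (c ⊔ ℓ)
  InFα α v = ∃ λ (w : Vect) →
    v ≈V ΣCells (λ r i → (if01 (toℕ i) (α r) (w r i)) • f r (toℕ i))
    where
    if01 : ℕ → ℕ → Carrier → Carrier
    if01 m a x with m <? a
    ... | yes _ = x
    ... | no  _ = 0#

  InImage : (Vect → Vect) → (Vect → Set (c ⊔ ℓ)) → Vect → Set (c ⊔ ℓ)
  InImage A S v = ∃ λ w → S w × (v ≈V A w)

  -- U_{i,j}(t): on the row of i,
  --   U (N^m f_i)       = N^m (f_i + t f_j)       (cell (r , a + m))
  --   U ((Nᵗ)^m f_i)    = (Nᵗ)^m (f_i + t f_j)    (cell (r , a - m))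
  -- and U f_ℓ = f_ℓ for ℓ not in the row of i.
  Ucol : CellPair s → Carrier → (r₀ : Fin s) → Fin (Lam r₀) → Vect
  Ucol (cp r a r' b) t r₀ i with r₀ ≟ᶠ r | a ≤? toℕ i
  ... | yes _ | yes _ = iter (toℕ i ∸ a) N  (f r a +V (t • f r' b))
  ... | yes _ | no  _ = iter (a ∸ toℕ i) Nᵗ (f r a +V (t • f r' b))
  ... | no  _ | _     = f r₀ (toℕ i)

  U : CellPair s → Carrier → Vect → Vect
  U π t = linMap (Ucol π t)

  -- Û_{i,j}(t): Û (N^m f_i) = N^m (f_i + t f_j), and Û f_ℓ = f_ℓ for ℓ
  -- not in the row of i or not weakly right of the cell of i.
  Ûcol : CellPair s → Carrier → (r₀ : Fin s) → Fin (Lam r₀) → Vect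
  Ûcol (cp r a r' b) t r₀ i with r₀ ≟ᶠ r | a ≤? toℕ i
  ... | yes _ | yes _ = iter (toℕ i ∸ a) N (f r a +V (t • f r' b))
  ... | _     | _     = f r₀ (toℕ i)

  Û : CellPair s → Carrier → Vect → Vect
  Û π t = linMap (Ûcol π t)

  -- apply a list of maps, head first:  applyAll g [(π₁,t₁),…,(π_p,t_p)] v
  --   = g π_p t_p ( … (g π₁ t₁ v))
  applyAll : (CellPair s → Carrier → Vect → Vect) → List (CellPair s × Carrier) → Vect → Vect
  applyAll g []             v = v
  applyAll g ((π , t) ∷ xs) v = applyAll g xs (g π t v)

module FreePairs (n k s : ℕ) (lam α : Fin s → ℕ) where
  open Shape s (Λ n k s lam) using (T)

  labelI : CellPair s → ℕ
  labelI (cp r a _ _) = T r a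

  -- (i , j) with i = T(r , a), j = T(r' , b) is a free pair for α iff
  --  * i > j,
  --  * the cell (r , a) lies in [α] \ [λ]  (λ_r ≤ a < α_r, 0-indexed a),
  --  * (r' , b) is the leftmost cell of [Λ] \ [α] in its row
  --    (b = α_{r'} and b < Λ_{r'}).
  IsFreePair : CellPair s → Set
  IsFreePair (cp r a r' b) =
    (T r' b < T r a) × (lam r ≤ a) × (a < α r) × (b ≡ α r') × (b < Λ n k s lam r')

-- Write U_{i,j}(t) = Û_{i,j}(t) ∘ Uˡ_{i,j}(t), where Uˡ_{i,j}(t) adds t (Nᵗ)^m f_j to the basis
-- vector m ≥ 1 cells left of i and fixes every other basis vector.  Since j is the first cell of
-- its row outside [α], every (Nᵗ)^m f_j with m ≥ 1 lies in F^α, so Uˡ_{i,j}(t) maps F^α onto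
-- itself (its inverse is Uˡ_{i,j}(-t)).  Listing the pairs with i decreasing makes each later Uˡ
-- commute with each earlier Û, so U_p ⋯ U_1 = Û_p ⋯ Û_1 ∘ Uˡ_p ⋯ Uˡ_1 and both sides have the
-- same image of F^α.

{-# OPTIONS --safe #-}
module Submission where

open import Defs
open import Level using (_⊔_)
open import Function using (_∘_; _on_; flip)
open import Data.Nat
  using (ℕ; zero; suc; _+_; _*_; _∸_; _≤_; _<_; _≤?_; _<?_; z≤n; s≤s; _≤′_; ≤′-refl; ≤′-step)
import Data.Nat.Properties as ℕ
open import Data.Fin using (Fin; toℕ; fromℕ<)
import Data.Fin as Fin
import Data.Fin.Properties as Finₚ
open Finₚ using (toℕ-injective; toℕ-fromℕ<) renaming (_≟_ to _≟ᶠ_)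
open import Data.Product using (∃; _×_; _,_; proj₁; proj₂)
open import Data.List using (List; []; _∷_; length; take; zip)
open import Data.Vec using (Vec; toList)
open import Data.List.Membership.Propositional using (_∈_)
open import Data.List.Relation.Unary.All as All using (All; []; _∷_)
import Data.List.Relation.Unary.All.Properties as All
open import Data.List.Relation.Unary.AllPairs using (AllPairs; []; _∷_)
import Data.List.Relation.Unary.AllPairs.Properties as AllPairs
open import Data.List.Relation.Unary.Linked using (Linked)
open import Data.List.Relation.Unary.Linked.Properties using (Linked⇒AllPairs)
open import Data.List.Relation.Unary.Unique.Propositional using (Unique)
open import Data.Sum using (_⊎_; inj₁; inj₂)
open import Data.Unit using (⊤)
open import Data.Empty using (⊥-elim)
open import Relation.Nullary using (¬_; ¬?; Dec; yes; no)
open import Relation.Nullary.Decidable using (_×-dec_)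
open import Function.Bundles using (_⇔_; mk⇔; Equivalence)
open import Relation.Binary.Bundles using (Setoid)
import Relation.Binary.PropositionalEquality as ≡
open ≡ using (_≡_; _≢_)

module Vectors {c ℓ} (F : Field c ℓ) (s : ℕ) (Lam : Fin s → ℕ) where
  open Field F renaming (_+_ to _+F_; _*_ to _*F_)
  open LinAlg F s Lam
  open import Algebra.Properties.Semiring.Sum semiring
    using (sum; sum-cong-≋; sum-replicate-zero; ∑-distrib-+; *-distribˡ-sum)

  ≈V-setoid : Setoid c ℓ
  ≈V-setoid = record
    { Carrier       = Vect
    ; _≈_           = _≈V_
    ; isEquivalence = record
      { refl  = λ _ _ → refl
      ; sym   = λ e r i → sym (e r i)
      ; trans = λ e e′ r i → trans (e r i) (e′ r i)
      }
    }

  module ≈V = Setoid ≈V-setoid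

  +V-cong : ∀ {v v′ w w′} → v ≈V v′ → w ≈V w′ → (v +V w) ≈V (v′ +V w′)
  +V-cong e e′ r i = +-cong (e r i) (e′ r i)

  •-congʳ : ∀ x {v w} → v ≈V w → (x • v) ≈V (x • w)
  •-congʳ x e r i = *-congˡ (e r i)

  ΣV-cong : ∀ n {g h : Fin n → Vect} → (∀ j → g j ≈V h j) → ΣV n g ≈V ΣV n h
  ΣV-cong zero    e = ≈V.refl
  ΣV-cong (suc n) e = +V-cong (e Fin.zero) (ΣV-cong n (e ∘ Fin.suc))

  ΣV-at : ∀ n (g : Fin n → Vect) r i → ΣV n g r i ≡ sum (λ j → g j r i)
  ΣV-at zero    g r i = ≡.refl
  ΣV-at (suc n) g r i = ≡.cong (g Fin.zero r i +F_) (ΣV-at n (g ∘ Fin.suc) r i)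

  ΣCells-at : ∀ g r i → ΣCells g r i ≈ sum (λ r′ → sum (λ i′ → g r′ i′ r i))
  ΣCells-at g r i = trans (reflexive (ΣV-at s _ r i))
                          (sum-cong-≋ (λ r′ → reflexive (ΣV-at (Lam r′) (g r′) r i)))

  sum-zero : ∀ {n} {h : Fin n → Carrier} → (∀ j → h j ≈ 0#) → sum h ≈ 0#
  sum-zero {n} h≈0 = trans (sum-cong-≋ h≈0) (sum-replicate-zero n)

  sum-δ : ∀ {n} {h : Fin n → Carrier} j₀ → (∀ j → j ≢ j₀ → h j ≈ 0#) → sum h ≈ h j₀
  sum-δ Fin.zero h≈0 =
    trans (+-congˡ (sum-zero (λ j → h≈0 (Fin.suc j) λ ()))) (+-identityʳ _)
  sum-δ (Fin.suc j₀) h≈0 =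
    trans (+-cong (h≈0 Fin.zero λ ())
                  (sum-δ j₀ (λ j j≢j₀ → h≈0 (Fin.suc j) (j≢j₀ ∘ Finₚ.suc-injective))))
          (+-identityˡ _)

  sum-cells-δ : ∀ {h : (r : Fin s) → Fin (Lam r) → Carrier} r₀ i₀
              → (∀ r → r ≢ r₀ → ∀ i → h r i ≈ 0#)
              → (∀ i → i ≢ i₀ → h r₀ i ≈ 0#)
              → sum (λ r → sum (h r)) ≈ h r₀ i₀
  sum-cells-δ r₀ i₀ offRow offColumn =
    trans (sum-δ r₀ (λ r r≢r₀ → sum-zero (offRow r r≢r₀))) (sum-δ i₀ offColumn)

  f-diagonal : ∀ r m r′ i → r ≡ r′ → m ≡ toℕ i → f r m r′ i ≈ 1#
  f-diagonal r m r′ i r≡r′ m≡i with r ≟ᶠ r′ | m ℕ.≟ toℕ i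
  ... | yes _    | yes _   = refl
  ... | no r≢r′  | _       = ⊥-elim (r≢r′ r≡r′)
  ... | yes _    | no m≢i  = ⊥-elim (m≢i m≡i)

  f-offDiagonal : ∀ r m r′ i → ¬ (r ≡ r′ × m ≡ toℕ i) → f r m r′ i ≈ 0#
  f-offDiagonal r m r′ i ne with r ≟ᶠ r′ | m ℕ.≟ toℕ i
  ... | yes r≡r′ | yes m≡i = ⊥-elim (ne (r≡r′ , m≡i))
  ... | yes _    | no _    = refl
  ... | no _     | _       = refl

  f-resp : ∀ r m r′ i r₁ m₁ r₁′ i₁
         → (r ≡ r′ × m ≡ toℕ i) ⇔ (r₁ ≡ r₁′ × m₁ ≡ toℕ i₁)
         → f r m r′ i ≈ f r₁ m₁ r₁′ i₁
  f-resp r m r′ i r₁ m₁ r₁′ i₁ same = by-cases ((r ≟ᶠ r′) ×-dec (m ℕ.≟ toℕ i))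
    where
    by-cases : Dec (r ≡ r′ × m ≡ toℕ i) → f r m r′ i ≈ f r₁ m₁ r₁′ i₁
    by-cases (yes (r≡r′ , m≡i)) =
      let (r₁≡r₁′ , m₁≡i₁) = Equivalence.to same (r≡r′ , m≡i)
      in trans (f-diagonal r m r′ i r≡r′ m≡i)
               (sym (f-diagonal r₁ m₁ r₁′ i₁ r₁≡r₁′ m₁≡i₁))
    by-cases (no ne) =
      trans (f-offDiagonal r m r′ i ne)
            (sym (f-offDiagonal r₁ m₁ r₁′ i₁ (ne ∘ Equivalence.from same)))

  ΣCells-•f : ∀ (h : (r : Fin s) → Fin (Lam r) → Carrier) r i
            → ΣCells (λ r′ i′ → h r′ i′ • f r′ (toℕ i′)) r i ≈ h r i
  ΣCells-•f h r i = trans (ΣCells-at _ r i) (trans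
    (sum-cells-δ r i
      (λ r′ r′≢r i′ →
        trans (*-congˡ (f-offDiagonal r′ (toℕ i′) r i (r′≢r ∘ proj₁))) (zeroʳ _))
      (λ i′ i′≢i →
        trans (*-congˡ (f-offDiagonal r (toℕ i′) r i (i′≢i ∘ toℕ-injective ∘ proj₂)))
              (zeroʳ _)))
    (trans (*-congˡ (f-diagonal r (toℕ i) r i ≡.refl ≡.refl)) (*-identityʳ _)))

  expand : ∀ v → v ≈V ΣCells (λ r i → v r i • f r (toℕ i))
  expand v r i = sym (ΣCells-•f v r i)

  linMap-f : ∀ col r i → linMap col (f r (toℕ i)) ≈V col r i
  linMap-f col r i r′ i′ = trans (ΣCells-at _ r′ i′) (trans
    (sum-cells-δ r i
      (λ r″ r″≢r i″ →
        trans (*-congʳ (f-offDiagonal r (toℕ i) r″ i″ (r″≢r ∘ ≡.sym ∘ proj₁))) (zeroˡ _))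
      (λ i″ i″≢i →
        trans (*-congʳ (f-offDiagonal r (toℕ i) r i″ (i″≢i ∘ toℕ-injective ∘ ≡.sym ∘ proj₂)))
              (zeroˡ _)))
    (trans (*-congʳ (f-diagonal r (toℕ i) r i ≡.refl ≡.refl)) (*-identityˡ _)))

  linMap-entry : ∀ col v r i
               → (∀ r′ i′ → v r′ i′ *F col r′ i′ r i
                           ≈ v r′ i′ *F f r′ (toℕ i′) r i)
               → linMap col v r i ≈ v r i
  linMap-entry col v r i agree = trans (ΣCells-at _ r i)
    (trans (sum-cong-≋ (λ r′ → sum-cong-≋ (agree r′)))
    (trans (sym (ΣCells-at _ r i)) (ΣCells-•f v r i)))

  linMap-fixes : ∀ col v → (∀ r i → v r i ≈ 0# ⊎ col r i ≈V f r (toℕ i))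
               → linMap col v ≈V v
  linMap-fixes col v fixed r i = linMap-entry col v r i agree
    where
    agree : ∀ r′ i′ → v r′ i′ *F col r′ i′ r i ≈ v r′ i′ *F f r′ (toℕ i′) r i
    agree r′ i′ with fixed r′ i′
    ... | inj₁ v≈0   = trans (*-congʳ v≈0) (trans (zeroˡ _) (sym (trans (*-congʳ v≈0) (zeroˡ _))))
    ... | inj₂ col≈f = *-congˡ (col≈f r i)

  record IsLinear (A : Vect → Vect) : Set (c ⊔ ℓ) where
    field
      cong   : ∀ {v w} → v ≈V w → A v ≈V A w
      +-homo : ∀ v w → A (v +V w) ≈V (A v +V A w)
      •-homo : ∀ x v → A (x • v) ≈V (x • A v)

    0-homo : A 0V ≈V 0V
    0-homo = ≈V.trans (cong (λ _ _ → sym (zeroˡ 0#)))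
                      (≈V.trans (•-homo 0# 0V) (λ _ _ → zeroˡ _))

    +•-homo : ∀ u x w → A (u +V (x • w)) ≈V (A u +V (x • A w))
    +•-homo u x w = ≈V.trans (+-homo u _) (+V-cong ≈V.refl (•-homo x w))

    ΣV-homo : ∀ n g → A (ΣV n g) ≈V ΣV n (A ∘ g)
    ΣV-homo zero    g = 0-homo
    ΣV-homo (suc n) g = ≈V.trans (+-homo _ _) (+V-cong ≈V.refl (ΣV-homo n (g ∘ Fin.suc)))

  open IsLinear public

  id-isLinear : IsLinear (λ v → v)
  id-isLinear = record { cong = λ e → e ; +-homo = λ _ _ → ≈V.refl ; •-homo = λ _ _ → ≈V.refl }

  ∘-isLinear : ∀ {A B} → IsLinear A → IsLinear B → IsLinear (A ∘ B)
  ∘-isLinear A B = record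
    { cong   = cong A ∘ cong B
    ; +-homo = λ v w → ≈V.trans (cong A (+-homo B v w)) (+-homo A _ _)
    ; •-homo = λ x v → ≈V.trans (cong A (•-homo B x v)) (•-homo A _ _)
    }

  linMap-isLinear : ∀ col → IsLinear (linMap col)
  linMap-isLinear col = record { cong = linMap-cong ; +-homo = linMap-+ ; •-homo = linMap-• }
    where
    entry : Vect → (r : Fin s) → Fin (Lam r) → (r′ : Fin s) → Fin (Lam r′) → Carrier
    entry v r i r′ i′ = v r′ i′ *F col r′ i′ r i

    linMap-cong : ∀ {v w} → v ≈V w → linMap col v ≈V linMap col w
    linMap-cong v≈w r i = trans (ΣCells-at _ r i) (trans
      (sum-cong-≋ (λ r′ → sum-cong-≋ (λ i′ → *-congʳ (v≈w r′ i′))))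
      (sym (ΣCells-at _ r i)))

    linMap-+ : ∀ v w → linMap col (v +V w) ≈V (linMap col v +V linMap col w)
    linMap-+ v w r i = trans (ΣCells-at _ r i) (trans
      (sum-cong-≋ (λ r′ →
        trans (sum-cong-≋ (λ i′ → distribʳ (col r′ i′ r i) (v r′ i′) (w r′ i′)))
              (∑-distrib-+ (entry v r i r′) (entry w r i r′))))
      (trans (∑-distrib-+ (λ r′ → sum (entry v r i r′)) (λ r′ → sum (entry w r i r′)))
             (sym (+-cong (ΣCells-at _ r i) (ΣCells-at _ r i)))))

    linMap-• : ∀ x v → linMap col (x • v) ≈V (x • linMap col v)
    linMap-• x v r i = trans (ΣCells-at _ r i) (trans
      (sum-cong-≋ (λ r′ →
        trans (sum-cong-≋ (λ i′ → *-assoc x (v r′ i′) (col r′ i′ r i)))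
              (sym (*-distribˡ-sum x (entry v r i r′)))))
      (trans (sym (*-distribˡ-sum x (λ r′ → sum (entry v r i r′))))
             (*-congˡ (sym (ΣCells-at _ r i)))))

  linear-ext : ∀ {A B} → IsLinear A → IsLinear B
             → (∀ r i → A (f r (toℕ i)) ≈V B (f r (toℕ i))) → ∀ v → A v ≈V B v
  linear-ext {A} {B} linA linB onBasis v = begin
    A v                                         ≈⟨ cong linA (expand v) ⟩
    A (ΣCells (λ r i → v r i • f r (toℕ i)))    ≈⟨ expandThrough linA ⟩
    ΣCells (λ r i → v r i • A (f r (toℕ i)))    ≈⟨ ΣCells-cong (λ r i → •-congʳ _ (onBasis r i)) ⟩
    ΣCells (λ r i → v r i • B (f r (toℕ i)))    ≈⟨ expandThrough linB ⟨
    B (ΣCells (λ r i → v r i • f r (toℕ i)))    ≈⟨ cong linB (expand v) ⟨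
    B v                                         ∎
    where
    open import Relation.Binary.Reasoning.Setoid ≈V-setoid
    expandThrough : ∀ {C} → IsLinear C
                  → C (ΣCells (λ r i → v r i • f r (toℕ i)))
                    ≈V ΣCells (λ r i → v r i • C (f r (toℕ i)))
    expandThrough linC = ≈V.trans (ΣV-homo linC s _)
      (ΣV-cong s (λ r → ≈V.trans (ΣV-homo linC (Lam r) _)
                                 (ΣV-cong (Lam r) (λ i → •-homo linC _ _))))
    ΣCells-cong : ∀ {g h : (r : Fin s) → Fin (Lam r) → Vect}
                → (∀ r i → g r i ≈V h r i) → ΣCells g ≈V ΣCells h
    ΣCells-cong g≈h = ΣV-cong s (λ r → ΣV-cong (Lam r) (g≈h r))

  get-cong : ∀ {v w} → v ≈V w → ∀ r m → get v r m ≈ get w r m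
  get-cong v≈w r m with m <? Lam r
  ... | yes _ = v≈w r _
  ... | no _  = refl

  get-+ : ∀ v w r m → get (v +V w) r m ≈ get v r m +F get w r m
  get-+ v w r m with m <? Lam r
  ... | yes _ = refl
  ... | no _  = sym (+-identityʳ 0#)

  get-• : ∀ x v r m → get (x • v) r m ≈ x *F get v r m
  get-• x v r m with m <? Lam r
  ... | yes _ = refl
  ... | no _  = sym (zeroʳ x)

  Nᵗ-isLinear : IsLinear Nᵗ
  Nᵗ-isLinear = record
    { cong   = λ v≈w r i → get-cong v≈w r (suc (toℕ i))
    ; +-homo = λ v w r i → get-+ v w r (suc (toℕ i))
    ; •-homo = λ x v r i → get-• x v r (suc (toℕ i))
    }

  N-isLinear : IsLinear N
  N-isLinear = record { cong = N-cong ; +-homo = N-+ ; •-homo = N-• }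
    where
    N-cong : ∀ {v w} → v ≈V w → N v ≈V N w
    N-cong v≈w r i with toℕ i
    ... | zero  = refl
    ... | suc m = get-cong v≈w r m

    N-+ : ∀ v w → N (v +V w) ≈V (N v +V N w)
    N-+ v w r i with toℕ i
    ... | zero  = sym (+-identityʳ 0#)
    ... | suc m = get-+ v w r m

    N-• : ∀ x v → N (x • v) ≈V (x • N v)
    N-• x v r i with toℕ i
    ... | zero  = sym (zeroʳ x)
    ... | suc m = get-• x v r m

  iter-isLinear : ∀ {A} → IsLinear A → ∀ d → IsLinear (iter d A)
  iter-isLinear linA zero    = id-isLinear
  iter-isLinear linA (suc d) = ∘-isLinear linA (iter-isLinear linA d)

  Nᵗ-f : ∀ r m → suc m < Lam r → Nᵗ (f r (suc m)) ≈V f r m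
  Nᵗ-f r m m+1<Lam r′ i with suc (toℕ i) <? Lam r′
  ... | yes i+1<Lam = f-resp r (suc m) r′ _ r m r′ i (mk⇔
    (λ (r≡r′ , m+1≡) → r≡r′ , ℕ.suc-injective (≡.trans m+1≡ (toℕ-fromℕ< i+1<Lam)))
    (λ (r≡r′ , m≡i)  → r≡r′ , ≡.trans (≡.cong suc m≡i) (≡.sym (toℕ-fromℕ< i+1<Lam))))
  ... | no i+1≮Lam  = sym (f-offDiagonal r m r′ i λ { (≡.refl , ≡.refl) → i+1≮Lam m+1<Lam })

  iter-suc : ∀ d (g : Vect → Vect) v → iter (suc d) g v ≡ iter d g (g v)
  iter-suc zero    g v = ≡.refl
  iter-suc (suc d) g v = ≡.cong g (iter-suc d g v)

  Nᵗ^-f : ∀ r d m → d + m < Lam r → iter d Nᵗ (f r (d + m)) ≈V f r m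
  Nᵗ^-f r zero    m m<Lam   = ≈V.refl
  Nᵗ^-f r (suc d) m d+m<Lam = begin
    iter (suc d) Nᵗ (f r (suc d + m))  ≡⟨ iter-suc d Nᵗ _ ⟩
    iter d Nᵗ (Nᵗ (f r (suc d + m)))   ≈⟨ cong (iter-isLinear Nᵗ-isLinear d)
                                                (Nᵗ-f r (d + m) d+m<Lam) ⟩
    iter d Nᵗ (f r (d + m))            ≈⟨ Nᵗ^-f r d m (ℕ.<-trans (ℕ.n<1+n _) d+m<Lam) ⟩
    f r m                              ∎
    where open import Relation.Binary.Reasoning.Setoid ≈V-setoid

  Nᵗ^-f-∸ : ∀ r {m m′} → m′ ≤ m → m < Lam r → iter (m ∸ m′) Nᵗ (f r m) ≈V f r m′
  Nᵗ^-f-∸ r {m} {m′} m′≤m m<Lam =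
    ≡.subst (λ m″ → iter (m ∸ m′) Nᵗ (f r m″) ≈V f r m′) m∸m′+m′≡m
      (Nᵗ^-f r (m ∸ m′) m′ (≡.subst (_< Lam r) (≡.sym m∸m′+m′≡m) m<Lam))
    where
    m∸m′+m′≡m : m ∸ m′ + m′ ≡ m
    m∸m′+m′≡m = ℕ.m∸n+n≡m m′≤m

  record VanishesOn (ρ : Fin s) (P : ℕ → Set) (v : Vect) : Set ℓ where
    constructor vanishesOn
    field
      vanishes : ∀ i → P (toℕ i) → v ρ i ≈ 0#

  open VanishesOn public

  vanishesOn-weaken : ∀ {ρ P Q v} → (∀ m → Q m → P m) → VanishesOn ρ P v → VanishesOn ρ Q v
  vanishesOn-weaken Q⇒P van = vanishesOn λ i q → vanishes van i (Q⇒P _ q)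

  f-vanishesOn : ∀ {ρ P} r m → (r ≡ ρ → ¬ P m) → VanishesOn ρ P (f r m)
  f-vanishesOn {ρ} {P} r m ¬P = vanishesOn λ i p →
    f-offDiagonal r m ρ i λ (r≡ρ , m≡i) → ¬P r≡ρ (≡.subst P (≡.sym m≡i) p)

  +V-vanishesOn : ∀ {ρ P v w} → VanishesOn ρ P v → VanishesOn ρ P w → VanishesOn ρ P (v +V w)
  +V-vanishesOn vanV vanW = vanishesOn λ i p →
    trans (+-cong (vanishes vanV i p) (vanishes vanW i p)) (+-identityʳ 0#)

  •-vanishesOn : ∀ {ρ P v} x → VanishesOn ρ P v → VanishesOn ρ P (x • v)
  •-vanishesOn x van = vanishesOn λ i p → trans (*-congˡ (vanishes van i p)) (zeroʳ x)

  get-vanishes : ∀ {ρ P v} → VanishesOn ρ P v → ∀ m → P m → get v ρ m ≈ 0#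
  get-vanishes {ρ} {P} van m p with m <? Lam ρ
  ... | yes m<Lam = vanishes van (fromℕ< m<Lam) (≡.subst P (≡.sym (toℕ-fromℕ< m<Lam)) p)
  ... | no _      = refl

  Nᵗ-vanishesOn : ∀ {ρ P Q v} → (∀ m → Q m → P (suc m))
                → VanishesOn ρ P v → VanishesOn ρ Q (Nᵗ v)
  Nᵗ-vanishesOn Q⇒P van = vanishesOn λ i q → get-vanishes van _ (Q⇒P _ q)

  N-vanishesOn : ∀ {ρ P Q v} → (∀ m → Q (suc m) → P m)
               → VanishesOn ρ P v → VanishesOn ρ Q (N v)
  N-vanishesOn {Q = Q} {v} Q⇒P van = vanishesOn shifted
    where
    shifted : ∀ i → Q (toℕ i) → N v _ i ≈ 0#
    shifted i q with toℕ i
    ... | zero  = refl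
    ... | suc m = get-vanishes van m (Q⇒P m q)

  iter-vanishesOn : ∀ {ρ P g} → (∀ {v} → VanishesOn ρ P v → VanishesOn ρ P (g v))
                  → ∀ d {v} → VanishesOn ρ P v → VanishesOn ρ P (iter d g v)
  iter-vanishesOn step zero    van = van
  iter-vanishesOn step (suc d) van = step (iter-vanishesOn step d van)

  Nᵗ^-f-vanishesOn-otherRow : ∀ {ρ P} r m d → ρ ≢ r → VanishesOn ρ P (iter d Nᵗ (f r m))
  Nᵗ^-f-vanishesOn-otherRow {ρ} r m d ρ≢r = vanishesOn-weaken (λ _ _ → _)
    (iter-vanishesOn (Nᵗ-vanishesOn {P = λ _ → ⊤} _) d
      (f-vanishesOn r m λ r≡ρ _ → ρ≢r (≡.sym r≡ρ)))

  Nᵗ^-f-vanishesOn-≥ : ∀ r m {d} → 0 < d → VanishesOn r (m ≤_) (iter d Nᵗ (f r m))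
  Nᵗ^-f-vanishesOn-≥ r m {suc d} _ = ≡.subst (VanishesOn r (m ≤_)) (≡.sym (iter-suc d Nᵗ (f r m)))
    (iter-vanishesOn (Nᵗ-vanishesOn (λ _ → ℕ.m≤n⇒m≤1+n)) d
      (Nᵗ-vanishesOn {P = m <_} (λ _ → s≤s) (f-vanishesOn r m λ _ → ℕ.<-irrefl ≡.refl)))

  VanishesOutside : (Fin s → ℕ) → Vect → Set ℓ
  VanishesOutside α v = ∀ r i → α r ≤ toℕ i → v r i ≈ 0#

  -- InFα restricts w to [α] by a function local to its definition; unification against
  -- the definition recovers it.
  private
    Selector : Set c
    Selector = (Fin s → ℕ) → Vect → Vect → Vect

    selectorOf : {select : Selector}
               → (∀ α v → InFα α v
                          ≡ (∃ λ (w : Vect) →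
                               v ≈V ΣCells (λ r i → select α v w r i • f r (toℕ i))))
               → Selector
    selectorOf {select} _ = select

    select : Selector
    select = selectorOf (λ α v → ≡.refl)

    select-outside : ∀ α v w r i → α r ≤ toℕ i → select α v w r i ≈ 0#
    select-outside α v w r i α≤i with toℕ i <? α r
    ... | yes i<α = ⊥-elim (ℕ.<⇒≱ i<α α≤i)
    ... | no _    = refl

    select-inside : ∀ α v w r i → toℕ i < α r → select α v w r i ≈ w r i
    select-inside α v w r i i<α with toℕ i <? α r
    ... | yes _   = refl
    ... | no i≮α = ⊥-elim (i≮α i<α)

  InFα⇔VanishesOutside : ∀ α v → InFα α v ⇔ VanishesOutside α v
  InFα⇔VanishesOutside α v = mk⇔
    (λ (w , v≈) r i α≤i →
      trans (v≈ r i) (trans (ΣCells-•f _ r i) (select-outside α v w r i α≤i)))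
    (λ van → v , λ r i → sym (trans (ΣCells-•f _ r i) (selected van r i)))
    where
    selected : VanishesOutside α v → ∀ r i → select α v v r i ≈ v r i
    selected van r i = by-cases (toℕ i <? α r)
      where
      by-cases : Dec (toℕ i < α r) → select α v v r i ≈ v r i
      by-cases (yes i<α) = select-inside α v v r i i<α
      by-cases (no i≮α)  =
        trans (select-outside α v v r i (ℕ.≮⇒≥ i≮α)) (sym (van r i (ℕ.≮⇒≥ i≮α)))

sumℕ-cong : ∀ s {g h : Fin s → ℕ} → (∀ i → g i ≡ h i) → sumℕ s g ≡ sumℕ s h
sumℕ-cong zero    g≡h = ≡.refl
sumℕ-cong (suc s) g≡h = ≡.cong₂ _+_ (g≡h Fin.zero) (sumℕ-cong s (g≡h ∘ Fin.suc))

sumℕ-mono-≤ : ∀ s {g h : Fin s → ℕ} → (∀ i → g i ≤ h i) → sumℕ s g ≤ sumℕ s h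
sumℕ-mono-≤ zero    g≤h = z≤n
sumℕ-mono-≤ (suc s) g≤h = ℕ.+-mono-≤ (g≤h Fin.zero) (sumℕ-mono-≤ s (g≤h ∘ Fin.suc))

sumℕ-+ : ∀ s (g h : Fin s → ℕ) → sumℕ s (λ i → g i + h i) ≡ sumℕ s g + sumℕ s h
sumℕ-+ zero    g h = ≡.refl
sumℕ-+ (suc s) g h =
  ≡.trans (≡.cong (g Fin.zero + h Fin.zero +_) (sumℕ-+ s (g ∘ Fin.suc) (h ∘ Fin.suc)))
          (interchange (g Fin.zero) (h Fin.zero) _ _)
  where open import Algebra.Properties.CommutativeSemigroup ℕ.+-commutativeSemigroup using (interchange)

term≤sumℕ : ∀ s (g : Fin s → ℕ) i → g i ≤ sumℕ s g
term≤sumℕ (suc s) g Fin.zero    = ℕ.m≤m+n _ _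
term≤sumℕ (suc s) g (Fin.suc i) = ℕ.≤-trans (term≤sumℕ s (g ∘ Fin.suc) i) (ℕ.m≤n+m _ _)

α≤Λ : ∀ {n k s lam α} → IsPaddedPartition k s lam → IsComp n s α → (∀ i → lam i ≤ α i)
    → ∀ r → α r ≤ Λ n k s lam r
α≤Λ {n} {k} {s} {lam} {α} (_ , Σlam≡k) Σα≡n lam≤α r = begin
  α r                ≡⟨ ℕ.m+[n∸m]≡n (lam≤α r) ⟨
  lam r + excess r   ≤⟨ ℕ.+-monoʳ-≤ (lam r) (term≤sumℕ s excess r) ⟩
  lam r + Σexcess    ≡⟨ ≡.cong (lam r +_) Σexcess≡n∸k ⟩
  lam r + (n ∸ k)    ∎
  where
  open ℕ.≤-Reasoning
  excess : Fin s → ℕ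
  excess i = α i ∸ lam i
  Σexcess = sumℕ s excess
  Σexcess≡n∸k : Σexcess ≡ n ∸ k
  Σexcess≡n∸k = ≡.trans (≡.sym (ℕ.m+n∸m≡n k Σexcess)) (≡.cong (_∸ k) (begin-equality
    k + Σexcess                          ≡⟨ ≡.cong (_+ Σexcess) Σlam≡k ⟨
    sumℕ s lam + Σexcess                 ≡⟨ sumℕ-+ s lam excess ⟨
    sumℕ s (λ i → lam i + excess i)   ≡⟨ sumℕ-cong s (ℕ.m+[n∸m]≡n ∘ lam≤α) ⟩
    sumℕ s α                             ≡⟨ Σα≡n ⟩
    n                                    ∎))

module ReadingOrder (s : ℕ) (Lam : Fin s → ℕ) where
  open Shape s Lam

  cellsBefore-mono : ∀ {c c′} → c ≤′ c′ → cellsBefore c ≤ cellsBefore c′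
  cellsBefore-mono ≤′-refl           = ℕ.≤-refl
  cellsBefore-mono (≤′-step c≤′c′) = ℕ.≤-trans (cellsBefore-mono c≤′c′) (ℕ.m≤m+n _ _)

  T-monoʳ-< : ∀ r {c c′} → c < c′ → c′ < Lam r → T r c < T r c′
  T-monoʳ-< r {c} {c′} c<c′ c′<Lam = begin-strict
    T r c                ≤⟨ ℕ.+-monoʳ-≤ (cellsBefore c)
                               (sumℕ-mono-≤ s (λ r′ → rowWeight≤1 r′ (lt01 c (Lam r′)))) ⟩
    cellsBefore (suc c)        ≤⟨ cellsBefore-mono (ℕ.≤⇒≤′ c<c′) ⟩
    cellsBefore c′             <⟨ ℕ.m<m+n (cellsBefore c′) ownCell ⟩
    T r c′                     ∎
    where
    open ℕ.≤-Reasoning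
    rowWeight≤1 : ∀ r′ x → le01 r′ r * x ≤ x
    rowWeight≤1 r′ x with toℕ r′ ≤? toℕ r
    ... | yes _ = ℕ.≤-reflexive (ℕ.+-identityʳ x)
    ... | no _  = z≤n
    ownCell : 0 < sumℕ s (λ r′ → le01 r′ r * lt01 c′ (Lam r′))
    ownCell = ℕ.<-≤-trans (ℕ.≤-reflexive (≡.sym countsOwnCell)) (term≤sumℕ s _ r)
      where
      countsOwnCell : le01 r r * lt01 c′ (Lam r) ≡ 1
      countsOwnCell with toℕ r ≤? toℕ r | c′ <? Lam r
      ... | yes _ | yes _      = ≡.refl
      ... | no r≰r | _         = ⊥-elim (r≰r ℕ.≤-refl)
      ... | yes _ | no c′≮Lam  = ⊥-elim (c′≮Lam c′<Lam)

module FreePairMaps {c ℓ} (F : Field c ℓ) (n k s : ℕ) (lam α : Fin s → ℕ)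
                    (α≤Λ : ∀ r → α r ≤ Λ n k s lam r) where
  open Field F renaming (_+_ to _+F_; _*_ to _*F_; -_ to -F_)
  open LinAlg F s (Λ n k s lam)
  open Vectors F s (Λ n k s lam)
  open Shape s (Λ n k s lam) using (T)
  open ReadingOrder s (Λ n k s lam)
  open FreePairs n k s lam α

  module Free {r a r′ b} (free : IsFreePair (cp r a r′ b)) where
    j<i : T r′ b < T r a
    j<i = proj₁ free

    a<α : a < α r
    a<α = proj₁ (proj₂ (proj₂ free))

    a<Λ : a < Λ n k s lam r
    a<Λ = ℕ.<-≤-trans a<α (α≤Λ r)

    b≡α : b ≡ α r′
    b≡α = proj₁ (proj₂ (proj₂ (proj₂ free)))

    b<Λ : b < Λ n k s lam r′
    b<Λ = proj₂ (proj₂ (proj₂ (proj₂ free)))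

    -- In i's row, the first cell outside [α] lies right of i, hence has a larger label.
    r′≢r : r′ ≢ r
    r′≢r ≡.refl = ℕ.<-asym j<i (T-monoʳ-< r (≡.subst (a <_) (≡.sym b≡α) a<α) b<Λ)

  module Dominated {r a r′ b rq aq r′q bq}
                   (freeπ : IsFreePair (cp r a r′ b)) (freeq : IsFreePair (cp rq aq r′q bq))
                   (q≤π : T rq aq ≤ T r a) where
    private
      module π = Free freeπ
      module q = Free freeq

    sameRow⇒aq≤a : rq ≡ r → aq ≤ a
    sameRow⇒aq≤a ≡.refl with aq ≤? a
    ... | yes aq≤a = aq≤a
    ... | no aq≰a  = ⊥-elim (ℕ.<⇒≱ (T-monoʳ-< r (ℕ.≰⇒> aq≰a) q.a<Λ) q≤π)

    r′q≢r : r′q ≢ r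
    r′q≢r ≡.refl = ℕ.<⇒≱ (ℕ.<-trans jq-right-of-i q.j<i) q≤π
      where
      jq-right-of-i : T r a < T r bq
      jq-right-of-i = T-monoʳ-< r (≡.subst (a <_) (≡.sym q.b≡α) π.a<α) q.b<Λ

    rq≡r′⇒aq<b : rq ≡ r′ → aq < b
    rq≡r′⇒aq<b ≡.refl = ≡.subst (aq <_) (≡.sym π.b≡α) q.a<α

  -- The part of U left of the cell of i, so that U π t ≈ Û π t ∘ Uˡ π t.
  Uˡcol : CellPair s → Carrier → (r₀ : Fin s) → Fin (Λ n k s lam r₀) → Vect
  Uˡcol (cp r a r′ b) t r₀ i with r₀ ≟ᶠ r | a ≤? toℕ i
  ... | yes _ | yes _ = f r₀ (toℕ i)
  ... | yes _ | no _  = f r₀ (toℕ i) +V (t • iter (a ∸ toℕ i) Nᵗ (f r′ b))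
  ... | no _  | _     = f r₀ (toℕ i)

  Uˡ : CellPair s → Carrier → Vect → Vect
  Uˡ π t = linMap (Uˡcol π t)

  U-isLinear : ∀ π t → IsLinear (U π t)
  U-isLinear π t = linMap-isLinear (Ucol π t)

  Û-isLinear : ∀ π t → IsLinear (Û π t)
  Û-isLinear π t = linMap-isLinear (Ûcol π t)

  Uˡ-isLinear : ∀ π t → IsLinear (Uˡ π t)
  Uˡ-isLinear π t = linMap-isLinear (Uˡcol π t)

  module OnBasis {r : Fin s} {a : ℕ} {r′ : Fin s} {b : ℕ} (t : Carrier)
                 {r₀ : Fin s} (i : Fin (Λ n k s lam r₀)) where
    private
      π = cp r a r′ b
      e = f r₀ (toℕ i)
      fᵢ+tfⱼ = f r a +V (t • f r′ b)

    U-f-right : r₀ ≡ r → a ≤ toℕ i → U π t e ≈V iter (toℕ i ∸ a) N (fᵢ+tfⱼ)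
    U-f-right r₀≡r a≤i = ≈V.trans (linMap-f _ r₀ i) column
      where
      column : Ucol π t r₀ i ≈V iter (toℕ i ∸ a) N (fᵢ+tfⱼ)
      column with r₀ ≟ᶠ r | a ≤? toℕ i
      ... | yes _    | yes _   = ≈V.refl
      ... | yes _    | no a≰i  = ⊥-elim (a≰i a≤i)
      ... | no r₀≢r  | _       = ⊥-elim (r₀≢r r₀≡r)

    U-f-left : r₀ ≡ r → ¬ a ≤ toℕ i → U π t e ≈V iter (a ∸ toℕ i) Nᵗ (fᵢ+tfⱼ)
    U-f-left r₀≡r a≰i = ≈V.trans (linMap-f _ r₀ i) column
      where
      column : Ucol π t r₀ i ≈V iter (a ∸ toℕ i) Nᵗ (fᵢ+tfⱼ)
      column with r₀ ≟ᶠ r | a ≤? toℕ i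
      ... | yes _    | yes a≤i = ⊥-elim (a≰i a≤i)
      ... | yes _    | no _    = ≈V.refl
      ... | no r₀≢r  | _       = ⊥-elim (r₀≢r r₀≡r)

    U-f-otherRow : r₀ ≢ r → U π t e ≈V e
    U-f-otherRow r₀≢r = ≈V.trans (linMap-f _ r₀ i) column
      where
      column : Ucol π t r₀ i ≈V e
      column with r₀ ≟ᶠ r | a ≤? toℕ i
      ... | yes r₀≡r | _ = ⊥-elim (r₀≢r r₀≡r)
      ... | no _     | _ = ≈V.refl

    Û-f-right : r₀ ≡ r → a ≤ toℕ i → Û π t e ≈V iter (toℕ i ∸ a) N (fᵢ+tfⱼ)
    Û-f-right r₀≡r a≤i = ≈V.trans (linMap-f _ r₀ i) column
      where
      column : Ûcol π t r₀ i ≈V iter (toℕ i ∸ a) N (fᵢ+tfⱼ)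
      column with r₀ ≟ᶠ r | a ≤? toℕ i
      ... | yes _    | yes _   = ≈V.refl
      ... | yes _    | no a≰i  = ⊥-elim (a≰i a≤i)
      ... | no r₀≢r  | _       = ⊥-elim (r₀≢r r₀≡r)

    Û-f-fixed : ¬ (r₀ ≡ r × a ≤ toℕ i) → Û π t e ≈V e
    Û-f-fixed notRight = ≈V.trans (linMap-f _ r₀ i) column
      where
      column : Ûcol π t r₀ i ≈V e
      column with r₀ ≟ᶠ r | a ≤? toℕ i
      ... | yes r₀≡r | yes a≤i = ⊥-elim (notRight (r₀≡r , a≤i))
      ... | yes _    | no _    = ≈V.refl
      ... | no _     | _       = ≈V.refl

    Uˡ-f-left : r₀ ≡ r → ¬ a ≤ toℕ i
              → Uˡ π t e ≈V (e +V (t • iter (a ∸ toℕ i) Nᵗ (f r′ b)))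
    Uˡ-f-left r₀≡r a≰i = ≈V.trans (linMap-f _ r₀ i) column
      where
      column : Uˡcol π t r₀ i ≈V (e +V (t • iter (a ∸ toℕ i) Nᵗ (f r′ b)))
      column with r₀ ≟ᶠ r | a ≤? toℕ i
      ... | yes _    | yes a≤i = ⊥-elim (a≰i a≤i)
      ... | yes _    | no _    = ≈V.refl
      ... | no r₀≢r  | _       = ⊥-elim (r₀≢r r₀≡r)

    Uˡ-f-fixed : ¬ (r₀ ≡ r × ¬ a ≤ toℕ i) → Uˡ π t e ≈V e
    Uˡ-f-fixed notLeft = ≈V.trans (linMap-f _ r₀ i) column
      where
      column : Uˡcol π t r₀ i ≈V e
      column with r₀ ≟ᶠ r | a ≤? toℕ i
      ... | yes _    | yes _   = ≈V.refl
      ... | yes r₀≡r | no a≰i  = ⊥-elim (notLeft (r₀≡r , a≰i))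
      ... | no _     | _       = ≈V.refl

  open OnBasis

  Û-fixes : ∀ {r a r′ b} t {v} → VanishesOn r (a ≤_) v → Û (cp r a r′ b) t v ≈V v
  Û-fixes {r} {a} {r′} {b} t {v} van = linMap-fixes (Ûcol (cp r a r′ b) t) v fixed
    where
    fixed : ∀ r₀ i → v r₀ i ≈ 0# ⊎ Ûcol (cp r a r′ b) t r₀ i ≈V f r₀ (toℕ i)
    fixed r₀ i with r₀ ≟ᶠ r | a ≤? toℕ i
    ... | yes ≡.refl | yes a≤i = inj₁ (vanishes van i a≤i)
    ... | yes _      | no _    = inj₂ ≈V.refl
    ... | no _       | _       = inj₂ ≈V.refl

  Uˡ-fixes : ∀ {r a r′ b} t {v} → VanishesOn r (_< a) v → Uˡ (cp r a r′ b) t v ≈V v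
  Uˡ-fixes {r} {a} {r′} {b} t {v} van = linMap-fixes (Uˡcol (cp r a r′ b) t) v fixed
    where
    fixed : ∀ r₀ i → v r₀ i ≈ 0# ⊎ Uˡcol (cp r a r′ b) t r₀ i ≈V f r₀ (toℕ i)
    fixed r₀ i with r₀ ≟ᶠ r | a ≤? toℕ i
    ... | yes _      | yes _   = inj₂ ≈V.refl
    ... | yes ≡.refl | no a≰i  = inj₁ (vanishes van i (ℕ.≰⇒> a≰i))
    ... | no _       | _       = inj₂ ≈V.refl

  -- Uˡ only adds multiples of (Nᵗ)^d f_j with d ≥ 1, which live in j's row left of j.
  Uˡ-unchanged : ∀ {r a r′ b} t v ρ x → (ρ ≡ r′ → b ≤ toℕ x)
               → Uˡ (cp r a r′ b) t v ρ x ≈ v ρ x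
  Uˡ-unchanged {r} {a} {r′} {b} t v ρ x outsideStrip =
    linMap-entry (Uˡcol (cp r a r′ b) t) v ρ x agree
    where
    shifted-j-vanishes : ∀ {d} → 0 < d → iter d Nᵗ (f r′ b) ρ x ≈ 0#
    shifted-j-vanishes {d} 0<d with ρ ≟ᶠ r′
    ... | yes ≡.refl = vanishes (Nᵗ^-f-vanishesOn-≥ r′ b 0<d) x (outsideStrip ≡.refl)
    ... | no ρ≢r′    = vanishes (Nᵗ^-f-vanishesOn-otherRow {P = λ _ → ⊤} r′ b d ρ≢r′) x _

    agree : ∀ r₁ i₁ → v r₁ i₁ *F Uˡcol (cp r a r′ b) t r₁ i₁ ρ x
                    ≈ v r₁ i₁ *F f r₁ (toℕ i₁) ρ x
    agree r₁ i₁ with r₁ ≟ᶠ r | a ≤? toℕ i₁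
    ... | yes _ | yes _  = refl
    ... | yes _ | no a≰i = *-congˡ (trans
      (+-congˡ (trans (*-congˡ (shifted-j-vanishes (ℕ.m<n⇒0<n∸m (ℕ.≰⇒> a≰i)))) (zeroʳ t)))
      (+-identityʳ _))
    ... | no _  | _      = refl

  U≈Û∘Uˡ : ∀ {π} → IsFreePair π → ∀ t v → U π t v ≈V Û π t (Uˡ π t v)
  U≈Û∘Uˡ {cp r a r′ b} free t =
    linear-ext (U-isLinear π t) (∘-isLinear (Û-isLinear π t) (Uˡ-isLinear π t)) onBasis
    where
    open Free free
    open import Relation.Binary.Reasoning.Setoid ≈V-setoid
    π = cp r a r′ b
    onBasis : ∀ r₀ i → U π t (f r₀ (toℕ i)) ≈V Û π t (Uˡ π t (f r₀ (toℕ i)))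
    onBasis r₀ i with r₀ ≟ᶠ r | a ≤? toℕ i
    ... | yes r₀≡r | yes a≤i = begin
      U π t (f r₀ (toℕ i))                        ≈⟨ U-f-right t i r₀≡r a≤i ⟩
      iter (toℕ i ∸ a) N (f r a +V (t • f r′ b))  ≈⟨ Û-f-right t i r₀≡r a≤i ⟨
      Û π t (f r₀ (toℕ i))                        ≈⟨ cong (Û-isLinear π t) (Uˡ-f-fixed t i notLeft) ⟨
      Û π t (Uˡ π t (f r₀ (toℕ i)))               ∎
      where
      notLeft : ¬ (r₀ ≡ r × ¬ a ≤ toℕ i)
      notLeft (_ , a≰i) = a≰i a≤i
    ... | yes ≡.refl | no a≰i = begin
      U π t e                              ≈⟨ U-f-left t i ≡.refl a≰i ⟩
      iter d Nᵗ (f r a +V (t • f r′ b))    ≈⟨ +•-homo (iter-isLinear Nᵗ-isLinear d) _ t _ ⟩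
      iter d Nᵗ (f r a) +V (t • g)         ≈⟨ +V-cong (Nᵗ^-f-∸ r i≤a a<Λ) ≈V.refl ⟩
      e +V (t • g)                         ≈⟨ +V-cong (Û-f-fixed t i λ (_ , a≤i) → a≰i a≤i)
                                                      (•-congʳ t (Û-fixes t g-offRow)) ⟨
      Û π t e +V (t • Û π t g)             ≈⟨ +•-homo (Û-isLinear π t) e t g ⟨
      Û π t (e +V (t • g))                 ≈⟨ cong (Û-isLinear π t) (Uˡ-f-left t i ≡.refl a≰i) ⟨
      Û π t (Uˡ π t e)                     ∎
      where
      e = f r (toℕ i)
      d = a ∸ toℕ i
      g = iter d Nᵗ (f r′ b)
      i≤a : toℕ i ≤ a
      i≤a = ℕ.<⇒≤ (ℕ.≰⇒> a≰i)
      g-offRow : VanishesOn r (a ≤_) g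
      g-offRow = Nᵗ^-f-vanishesOn-otherRow r′ b d (r′≢r ∘ ≡.sym)
    ... | no r₀≢r | _ = begin
      U π t (f r₀ (toℕ i))                 ≈⟨ U-f-otherRow t i r₀≢r ⟩
      f r₀ (toℕ i)                         ≈⟨ Û-f-fixed t i (r₀≢r ∘ proj₁) ⟨
      Û π t (f r₀ (toℕ i))                 ≈⟨ cong (Û-isLinear π t)
                                                   (Uˡ-f-fixed t i (r₀≢r ∘ proj₁)) ⟨
      Û π t (Uˡ π t (f r₀ (toℕ i)))        ∎

  Uˡ-Û-comm : ∀ {π q} → IsFreePair π → IsFreePair q → labelI q ≤ labelI π
            → ∀ tπ tq v → Uˡ q tq (Û π tπ v) ≈V Û π tπ (Uˡ q tq v)
  Uˡ-Û-comm {cp r a r′ b} {cp rq aq r′q bq} freeπ freeq q≤π tπ tq =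
    linear-ext (∘-isLinear (Uˡ-isLinear q tq) (Û-isLinear π tπ))
               (∘-isLinear (Û-isLinear π tπ) (Uˡ-isLinear q tq)) onBasis
    where
    open Dominated freeπ freeq q≤π
    open import Relation.Binary.Reasoning.Setoid ≈V-setoid
    π = cp r a r′ b
    q = cp rq aq r′q bq
    onBasis : ∀ r₀ i → Uˡ q tq (Û π tπ (f r₀ (toℕ i)))
                    ≈V Û π tπ (Uˡ q tq (f r₀ (toℕ i)))
    onBasis r₀ i with (r₀ ≟ᶠ r) ×-dec (a ≤? toℕ i)
    ... | yes (≡.refl , a≤i) = begin
      Uˡ q tq (Û π tπ e)   ≈⟨ cong (Uˡ-isLinear q tq) (Û-f-right tπ i ≡.refl a≤i) ⟩
      Uˡ q tq w            ≈⟨ Uˡ-fixes tq w-leftOf-aq ⟩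
      w                    ≈⟨ Û-f-right tπ i ≡.refl a≤i ⟨
      Û π tπ e             ≈⟨ cong (Û-isLinear π tπ) (Uˡ-f-fixed tq i eNotLeftOf-aq) ⟨
      Û π tπ (Uˡ q tq e)   ∎
      where
      e = f r (toℕ i)
      w = iter (toℕ i ∸ a) N (f r a +V (tπ • f r′ b))
      w-leftOf-aq : VanishesOn rq (_< aq) w
      w-leftOf-aq = iter-vanishesOn (N-vanishesOn (λ _ → ℕ.<-trans (ℕ.n<1+n _))) (toℕ i ∸ a)
        (+V-vanishesOn
          (f-vanishesOn r a λ r≡rq a<aq → ℕ.<⇒≱ a<aq (sameRow⇒aq≤a (≡.sym r≡rq)))
          (•-vanishesOn tπ (f-vanishesOn r′ b λ r′≡rq b<aq →
                              ℕ.<-asym b<aq (rq≡r′⇒aq<b (≡.sym r′≡rq)))))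
      eNotLeftOf-aq : ¬ (r ≡ rq × ¬ aq ≤ toℕ i)
      eNotLeftOf-aq (r≡rq , aq≰i) = aq≰i (ℕ.≤-trans (sameRow⇒aq≤a (≡.sym r≡rq)) a≤i)
    ... | no notRight = begin
      Uˡ q tq (Û π tπ e)   ≈⟨ cong (Uˡ-isLinear q tq) (Û-f-fixed tπ i notRight) ⟩
      Uˡ q tq e            ≈⟨ Û-fixes tπ Uˡe-rightOf-a ⟨
      Û π tπ (Uˡ q tq e)   ∎
      where
      e = f r₀ (toℕ i)
      e-rightOf-a : VanishesOn r (a ≤_) e
      e-rightOf-a = f-vanishesOn r₀ (toℕ i) λ r₀≡r a≤i → notRight (r₀≡r , a≤i)
      Uˡe-rightOf-a : VanishesOn r (a ≤_) (Uˡ q tq e)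
      Uˡe-rightOf-a = vanishesOn λ x a≤x →
        trans (Uˡ-unchanged tq e r x (⊥-elim ∘ r′q≢r ∘ ≡.sym)) (vanishes e-rightOf-a x a≤x)

  Uˡ-inverse : ∀ {π} → IsFreePair π → ∀ t v → Uˡ π t (Uˡ π (-F t) v) ≈V v
  Uˡ-inverse {cp r a r′ b} free t =
    linear-ext (∘-isLinear (Uˡ-isLinear π t) (Uˡ-isLinear π (-F t))) id-isLinear onBasis
    where
    open Free free
    open import Relation.Binary.Reasoning.Setoid ≈V-setoid
    π = cp r a r′ b
    onBasis : ∀ r₀ i → Uˡ π t (Uˡ π (-F t) (f r₀ (toℕ i))) ≈V f r₀ (toℕ i)
    onBasis r₀ i with (r₀ ≟ᶠ r) ×-dec (¬? (a ≤? toℕ i))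
    ... | yes (≡.refl , a≰i) = begin
      Uˡ π t (Uˡ π (-F t) e)             ≈⟨ cong (Uˡ-isLinear π t) (Uˡ-f-left (-F t) i ≡.refl a≰i) ⟩
      Uˡ π t (e +V ((-F t) • g))         ≈⟨ +•-homo (Uˡ-isLinear π t) e (-F t) g ⟩
      Uˡ π t e +V ((-F t) • Uˡ π t g)    ≈⟨ +V-cong (Uˡ-f-left t i ≡.refl a≰i)
                                                    (•-congʳ (-F t) (Uˡ-fixes t g-offRow)) ⟩
      (e +V (t • g)) +V ((-F t) • g)     ≈⟨ cancel ⟩
      e                                  ∎
      where
      e = f r (toℕ i)
      g = iter (a ∸ toℕ i) Nᵗ (f r′ b)
      g-offRow : VanishesOn r (_< a) g
      g-offRow = Nᵗ^-f-vanishesOn-otherRow r′ b (a ∸ toℕ i) (r′≢r ∘ ≡.sym)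
      cancel : ((e +V (t • g)) +V ((-F t) • g)) ≈V e
      cancel ρ x = trans (+-assoc _ _ _) (trans (+-congˡ (trans (sym (distribʳ _ t (-F t)))
                   (trans (*-congʳ (-‿inverseʳ t)) (zeroˡ _)))) (+-identityʳ _))
    ... | no notLeft = begin
      Uˡ π t (Uˡ π (-F t) (f r₀ (toℕ i)))  ≈⟨ cong (Uˡ-isLinear π t)
                                                    (Uˡ-f-fixed (-F t) i notLeft) ⟩
      Uˡ π t (f r₀ (toℕ i))                ≈⟨ Uˡ-f-fixed t i notLeft ⟩
      f r₀ (toℕ i)                         ∎

  Uˡ-preserves-VanishesOutside : ∀ {π} → IsFreePair π → ∀ t {v}
                               → VanishesOutside α v → VanishesOutside α (Uˡ π t v)
  Uˡ-preserves-VanishesOutside {cp r a r′ b} free t {v} van ρ x α≤x =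
    trans (Uˡ-unchanged t v ρ x λ { ≡.refl → ≡.subst (_≤ toℕ x) (≡.sym b≡α) α≤x })
          (van ρ x α≤x)
    where open Free free

  Dominates : CellPair s → CellPair s → Set
  Dominates π q = labelI q ≤ labelI π

  applyAll-isLinear : ∀ {g} → (∀ π t → IsLinear (g π t)) → ∀ xs → IsLinear (applyAll g xs)
  applyAll-isLinear linG []             = id-isLinear
  applyAll-isLinear linG ((π , t) ∷ xs) = ∘-isLinear (applyAll-isLinear linG xs) (linG π t)

  applyAll-Uˡ-Û-comm : ∀ {π} → IsFreePair π → ∀ tπ xs
                     → All (IsFreePair ∘ proj₁) xs → All (Dominates π ∘ proj₁) xs
                     → ∀ v → applyAll Uˡ xs (Û π tπ v) ≈V Û π tπ (applyAll Uˡ xs v)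
  applyAll-Uˡ-Û-comm freeπ tπ []              []             []               v = ≈V.refl
  applyAll-Uˡ-Û-comm freeπ tπ ((q , tq) ∷ xs) (freeq ∷ free) (q≤π ∷ dominated) v =
    ≈V.trans (cong (applyAll-isLinear Uˡ-isLinear xs) (Uˡ-Û-comm freeπ freeq q≤π tπ tq v))
             (applyAll-Uˡ-Û-comm freeπ tπ xs free dominated _)

  applyAll-U≈Û∘Uˡ : ∀ xs → All (IsFreePair ∘ proj₁) xs → AllPairs (Dominates on proj₁) xs
                  → ∀ v → applyAll U xs v ≈V applyAll Û xs (applyAll Uˡ xs v)
  applyAll-U≈Û∘Uˡ []             []            []                     v = ≈V.refl
  applyAll-U≈Û∘Uˡ ((π , t) ∷ xs) (freeπ ∷ free) (dominated ∷ sorted) v = begin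
    applyAll U xs (U π t v)                            ≈⟨ applyAll-U≈Û∘Uˡ xs free sorted _ ⟩
    applyAll Û xs (applyAll Uˡ xs (U π t v))           ≈⟨ cong Ûs (cong Uˡs (U≈Û∘Uˡ freeπ t v)) ⟩
    applyAll Û xs (applyAll Uˡ xs (Û π t (Uˡ π t v)))  ≈⟨ cong Ûs (applyAll-Uˡ-Û-comm freeπ t xs
                                                                    free dominated _) ⟩
    applyAll Û xs (Û π t (applyAll Uˡ xs (Uˡ π t v)))  ∎
    where
    open import Relation.Binary.Reasoning.Setoid ≈V-setoid
    Ûs = applyAll-isLinear Û-isLinear xs
    Uˡs = applyAll-isLinear Uˡ-isLinear xs

  applyAll-Uˡ-preserves-VanishesOutside : ∀ xs → All (IsFreePair ∘ proj₁) xs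
    → ∀ {v} → VanishesOutside α v → VanishesOutside α (applyAll Uˡ xs v)
  applyAll-Uˡ-preserves-VanishesOutside []             []             van = van
  applyAll-Uˡ-preserves-VanishesOutside ((π , t) ∷ xs) (freeπ ∷ free) van =
    applyAll-Uˡ-preserves-VanishesOutside xs free (Uˡ-preserves-VanishesOutside freeπ t van)

  applyAll-Uˡ-onto-VanishesOutside : ∀ xs → All (IsFreePair ∘ proj₁) xs
    → ∀ {v} → VanishesOutside α v → ∃ λ w → VanishesOutside α w × applyAll Uˡ xs w ≈V v
  applyAll-Uˡ-onto-VanishesOutside []             []             {v} van = v , van , ≈V.refl
  applyAll-Uˡ-onto-VanishesOutside ((π , t) ∷ xs) (freeπ ∷ free) van =
    let w , w-van , Uˡs-w≈v = applyAll-Uˡ-onto-VanishesOutside xs free van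
    in Uˡ π (-F t) w
     , Uˡ-preserves-VanishesOutside freeπ (-F t) w-van
     , ≈V.trans (cong (applyAll-isLinear Uˡ-isLinear xs) (Uˡ-inverse freeπ t w)) Uˡs-w≈v

  image-U⇔image-Û : ∀ xs → All (IsFreePair ∘ proj₁) xs → AllPairs (Dominates on proj₁) xs
    → ∀ v → InImage (applyAll U xs) (InFα α) v ⇔ InImage (applyAll Û xs) (InFα α) v
  image-U⇔image-Û xs free sorted v = mk⇔
    (λ (w , w∈Fα , v≈Uw) →
      applyAll Uˡ xs w ,
      fromVanishing (applyAll-Uˡ-preserves-VanishesOutside xs free (toVanishing w∈Fα)) ,
      ≈V.trans v≈Uw (applyAll-U≈Û∘Uˡ xs free sorted w))
    (λ (w , w∈Fα , v≈Ûw) →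
      let w′ , w′-van , Uˡs-w′≈w = applyAll-Uˡ-onto-VanishesOutside xs free (toVanishing w∈Fα)
      in w′ , fromVanishing w′-van ,
         ≈V.trans v≈Ûw (≈V.sym (≈V.trans (applyAll-U≈Û∘Uˡ xs free sorted w′)
                                          (cong (applyAll-isLinear Û-isLinear xs) Uˡs-w′≈w))))
    where
    toVanishing : ∀ {w} → InFα α w → VanishesOutside α w
    toVanishing = Equivalence.to (InFα⇔VanishesOutside α _)
    fromVanishing : ∀ {w} → VanishesOutside α w → InFα α w
    fromVanishing = Equivalence.from (InFα⇔VanishesOutside α _)

All-zip⁺ : ∀ {a b p} {A : Set a} {B : Set b} {P : A → Set p} {xs : List A} (ys : List B)
         → All P xs → All (P ∘ proj₁) (zip xs ys)
All-zip⁺ _        []         = []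
All-zip⁺ []       (_ ∷ _)    = []
All-zip⁺ (_ ∷ ys) (px ∷ pxs) = px ∷ All-zip⁺ ys pxs

AllPairs-zip⁺ : ∀ {a b r} {A : Set a} {B : Set b} {R : A → A → Set r} {xs : List A} (ys : List B)
              → AllPairs R xs → AllPairs (R on proj₁) (zip xs ys)
AllPairs-zip⁺ _        []         = []
AllPairs-zip⁺ []       (_ ∷ _)    = []
AllPairs-zip⁺ (_ ∷ ys) (rx ∷ rxs) = All-zip⁺ ys rx ∷ AllPairs-zip⁺ ys rxs

lemma4p8 : ∀ {c ℓ} (F : Field c ℓ) (n k s : ℕ) (lam : Fin s → ℕ)
    → k ≤ n → IsPaddedPartition k s lam
    → (α : Fin s → ℕ) → IsComp n s α → (∀ i → lam i ≤ α i)
    → (ps : List (CellPair s))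
    → Unique ps
    → (∀ π → (π ∈ ps) ⇔ FreePairs.IsFreePair n k s lam α π)
    → Linked (λ π₁ π₂ → FreePairs.labelI n k s lam α π₂ ≤ FreePairs.labelI n k s lam α π₁) ps
    → (p : ℕ) → p ≤ length ps → (ts : Vec (Field.Carrier F) p)
    → ∀ v
    → LinAlg.InImage F s (Λ n k s lam) (LinAlg.applyAll F s (Λ n k s lam) (LinAlg.U F s (Λ n k s lam)) (zip (take p ps) (toList ts))) (LinAlg.InFα F s (Λ n k s lam) α) v
    ⇔ LinAlg.InImage F s (Λ n k s lam) (LinAlg.applyAll F s (Λ n k s lam) (LinAlg.Û F s (Λ n k s lam)) (zip (take p ps) (toList ts))) (LinAlg.InFα F s (Λ n k s lam) α) v
lemma4p8 F n k s lam _ partition α comp lam≤α ps _ listsFreePairs decreasing p _ ts =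
  image-U⇔image-Û (zip (take p ps) (toList ts))
    (All-zip⁺ (toList ts) (All.take⁺ p listedAreFree))
    (AllPairs-zip⁺ (toList ts) (AllPairs.take⁺ p (Linked⇒AllPairs (flip ℕ.≤-trans) decreasing)))
  where
  open FreePairMaps F n k s lam α (α≤Λ partition comp lam≤α)
  listedAreFree : All (FreePairs.IsFreePair n k s lam α) ps
  listedAreFree = All.tabulate (Equivalence.to (listsFreePairs _))
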